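{- As $N\to\infty$, $$\sum_{n=0}^{N-1} t(n) = \frac{3N}{2} + \mathcal O\left(\log^2 N\right).$$
   Context: The Stern sequence $(s(n))_{n\ge0}$ is defined by $s(0)=0$, $s(1)=1$, $s(2n)=s(n)$, $s(2n+1)=s(n)+s(n+1)$. It is known that $s(n+1)\ge1$ for all $n\ge0$. Define $t(n)=\frac{s(n)}{s(n+1)}$ for $n\ge 0$. -}

module Defs where

open import Data.Nat using (ℕ; zero; suc; _+_; _*_; _/_; _%_)
open import Data.Integer using (+_)
open import Data.Rational using (ℚ; 0ℚ) renaming (_+_ to _+ℚ_; _/_ to _/ℚ_)
open import Relation.Binary.PropositionalEquality using (_≡_; refl)

-- Stern sequence, via a fuel-bounded recursion.
-- sF f n implements s(0)=0, s(1)=1, s(2k)=s(k), s(2k+1)=s(k)+s(k+1);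
-- fuel (suc n) always suffices, since all recursive arguments are < n for n ≥ 2.
sF : ℕ → ℕ → ℕ
sF zero n = 0
sF (suc f) zero = 0
sF (suc f) (suc zero) = 1
sF (suc f) (suc (suc m)) with suc (suc m) % 2
... | zero  = sF f (suc (suc m) / 2)
... | suc _ = sF f (suc (suc m) / 2) + sF f (suc (suc m) / 2 + 1)

s : ℕ → ℕ
s n = sF (suc n) n

_ : s 0 ≡ 0
_ = refl
_ : s 5 ≡ 3
_ = refl
_ : s 11 ≡ 5
_ = refl
_ : s 15 ≡ 4
_ = refl
_ : s 16 ≡ 1
_ = refl

-- t(n) = s(n)/s(n+1).  The branch s(n+1) = 0 never occurs (s(n+1) ≥ 1);
-- it is only there so the definition is total without a NonZero proof.
t : ℕ → ℚ
t n with s (suc n)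
... | zero  = 0ℚ
... | suc k = (+ s n) /ℚ suc k

T : ℕ → ℚ
T zero    = 0ℚ
T (suc N) = T N +ℚ t N

{-# OPTIONS --safe #-}
-- From s(2m) = s(m) and s(2m+1) = s(m) + s(m+1) one gets t(2m+1) = t(m) + 1 and
-- t(2m) = s(m) / (s(m) + s(m+1)).  Hence D(N) = T(N) - 3N/2 satisfies D(2M) = D(M) + E(M) and
-- D(2M+1) = D(M) + E(M+1) - 1, where E(M) = Σ_{m<M} (t(2m) - ½).  Cutting a sum E(2^d M) into M blocks
-- of length 2^d turns it into a sum of values Φ_d(s(m), s(m+1)) of one function Φ_d, which is increasing
-- in a/b and equals -½ at 0/1 and ½ at 1/0; so |Φ_d| ≤ ½ and |E(M)| ≤ k/2 for M < 2^k.  Unrolling the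
-- recursion for D along the k binary digits of N < 2^k gives |D(N)| ≤ k(k+3)/2.
module Submission where

open import Defs
open import Data.Nat using (ℕ; zero; suc; _+_; _*_; _^_; _≤_; _<_; z≤n; s≤s; z<s; _/_; _%_)
open import Data.Nat.Properties
open import Data.Nat.Divisibility using (divides-refl)
open import Data.Nat.DivMod using ([m+kn]%n≡m%n; m*n%n≡0; m*n/n≡m; +-distrib-/-∣ʳ)
open import Data.Nat.Induction using (<-rec)
open import Data.Nat.Logarithm using (⌊log₂_⌋; ⌊log₂⌋-mono-≤; ⌊log₂[2^n]⌋≡n)
import Data.Nat.Tactic.RingSolver as ℕ-Ring
open import Data.Integer as ℤ using (+_)
import Data.Integer.Properties as ℤ
import Data.Integer.Tactic.RingSolver as ℤ-Ring
open import Data.Product using (∃₂; _,_)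
open import Data.Sum using (inj₁; inj₂)
open import Data.Rational using (ℚ; 0ℚ; 1ℚ; ½; -½; -_; ∣_∣; toℚᵘ)
  renaming (_+_ to _+ℚ_; _-_ to _-ℚ_; _/_ to _/ℚ_; _≤_ to _≤ℚ_)
import Data.Rational.Properties as ℚ
open import Data.Rational.Solver using (module +-*-Solver)
open import Data.Rational.Unnormalised using (mkℚᵘ; *≡*; *≤*) renaming (_≃_ to _≃ᵘ_; _≤_ to _≤ᵘ_; _+_ to _+ᵘ_)
import Data.Rational.Unnormalised.Properties as ℚᵘ
open import Algebra.Properties.Group ℚ.+-0-group using (⁻¹-involutive)
open import Relation.Binary.PropositionalEquality

data Parity : ℕ → Set where
  even : ∀ m → Parity (2 * m)
  odd  : ∀ m → Parity (1 + 2 * m)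

parity : ∀ n → Parity n
parity zero = even 0
parity (suc n) with parity n
... | even m = odd m
... | odd m  = subst Parity (*-suc 2 m) (even (suc m))

1+n<2*[1+n] : ∀ n → suc n < 2 * suc n
1+n<2*[1+n] n = m<m+n (suc n) z<s

2+n<1+2*[1+n] : ∀ n → suc (suc n) < 1 + 2 * suc n
2+n<1+2*[1+n] n = s≤s (1+n<2*[1+n] n)

1+n<1+2*[1+n] : ∀ n → suc n < 1 + 2 * suc n
1+n<1+2*[1+n] n = <-trans (n<1+n (suc n)) (2+n<1+2*[1+n] n)

2*m<2*n⇒m<n : ∀ {m n} → 2 * m < 2 * n → m < n
2*m<2*n⇒m<n = *-cancelˡ-< 2 _ _

1+2*m<2*n⇒m<n : ∀ {m n} → 1 + 2 * m < 2 * n → m < n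
1+2*m<2*n⇒m<n lt = 2*m<2*n⇒m<n (<-trans (n<1+n _) lt)

-- `sF` branches on `n % 2`, which is stuck on open terms; these equations unfold it.
private
  sF-unfold-even : ∀ f m → suc (suc m) % 2 ≡ 0 → sF (suc f) (suc (suc m)) ≡ sF f (suc (suc m) / 2)
  sF-unfold-even f m n%2≡0 rewrite n%2≡0 = refl

  sF-unfold-odd : ∀ f m → suc (suc m) % 2 ≡ 1 →
    sF (suc f) (suc (suc m)) ≡ sF f (suc (suc m) / 2) + sF f (suc (suc m) / 2 + 1)
  sF-unfold-odd f m n%2≡1 rewrite n%2≡1 = refl

sF-even : ∀ f k → sF (suc f) (2 * suc k) ≡ sF f (suc k)
sF-even f k rewrite *-comm 2 (suc k) =
  trans (sF-unfold-even f (k * 2) (m*n%n≡0 (suc k) 2)) (cong (sF f) (m*n/n≡m (suc k) 2))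

sF-odd : ∀ f k → sF (suc f) (1 + 2 * suc k) ≡ sF f (suc k) + sF f (suc (suc k))
sF-odd f k = begin
  sF (suc f) (1 + 2 * suc k)                                  ≡⟨ cong (λ n → sF (suc f) (1 + n)) (*-comm 2 (suc k)) ⟩
  sF (suc f) (1 + suc k * 2)                                  ≡⟨ sF-unfold-odd f (suc (k * 2)) ([m+kn]%n≡m%n 1 (suc k) 2) ⟩
  sF f ((1 + suc k * 2) / 2) + sF f ((1 + suc k * 2) / 2 + 1) ≡⟨ cong (λ h → sF f h + sF f (h + 1)) half ⟩
  sF f (suc k) + sF f (suc k + 1)                             ≡⟨ cong (λ h → sF f (suc k) + sF f h) (+-comm (suc k) 1) ⟩
  sF f (suc k) + sF f (suc (suc k))                           ∎
  where
  open ≡-Reasoning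
  half : (1 + suc k * 2) / 2 ≡ suc k
  half = trans (+-distrib-/-∣ʳ 1 {d = 2} (divides-refl (suc k))) (m*n/n≡m (suc k) 2)

sF-fuel : ∀ {f g} n → n < f → n < g → sF f n ≡ sF g n
sF-fuel {suc f} {suc g} n (s≤s n≤f) (s≤s n≤g) with parity n
... | even zero    = refl
... | odd zero     = refl
... | even (suc k) = begin
  sF (suc f) (2 * suc k) ≡⟨ sF-even f k ⟩
  sF f (suc k)           ≡⟨ sF-fuel (suc k) (<-≤-trans (1+n<2*[1+n] k) n≤f) (<-≤-trans (1+n<2*[1+n] k) n≤g) ⟩
  sF g (suc k)           ≡⟨ sF-even g k ⟨
  sF (suc g) (2 * suc k) ∎
  where open ≡-Reasoning
... | odd (suc k)  = begin
  sF (suc f) (1 + 2 * suc k)        ≡⟨ sF-odd f k ⟩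
  sF f (suc k) + sF f (suc (suc k)) ≡⟨ cong₂ _+_
    (sF-fuel (suc k) (<-≤-trans (1+n<1+2*[1+n] k) n≤f) (<-≤-trans (1+n<1+2*[1+n] k) n≤g))
    (sF-fuel (suc (suc k)) (<-≤-trans (2+n<1+2*[1+n] k) n≤f) (<-≤-trans (2+n<1+2*[1+n] k) n≤g)) ⟩
  sF g (suc k) + sF g (suc (suc k)) ≡⟨ sF-odd g k ⟨
  sF (suc g) (1 + 2 * suc k)        ∎
  where open ≡-Reasoning

s-even : ∀ k → s (2 * k) ≡ s k
s-even zero    = refl
s-even (suc k) = trans (sF-even (2 * suc k) k) (sF-fuel (suc k) (1+n<2*[1+n] k) (n<1+n (suc k)))

s-odd : ∀ k → s (1 + 2 * k) ≡ s k + s (suc k)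
s-odd zero    = refl
s-odd (suc k) = trans (sF-odd (1 + 2 * suc k) k) (cong₂ _+_
  (sF-fuel (suc k) (1+n<1+2*[1+n] k) (n<1+n (suc k)))
  (sF-fuel (suc (suc k)) (2+n<1+2*[1+n] k) (n<1+n (suc (suc k)))))

s-even-suc : ∀ k → s (2 + 2 * k) ≡ s (suc k)
s-even-suc k = trans (cong s (sym (*-suc 2 k))) (s-even (suc k))

s-pos : ∀ n → 0 < s (suc n)
s-pos = <-rec (λ n → 0 < s (suc n)) step
  where
  step : ∀ n → (∀ {m} → m < n → 0 < s (suc m)) → 0 < s (suc n)
  step n rec with parity n
  ... | even zero    = z<s
  ... | even (suc m) = subst (0 <_) (sym (s-odd (suc m))) (<-≤-trans (rec (1+n<2*[1+n] m)) (m≤n+m _ _))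
  ... | odd m        = subst (0 <_) (sym (s-even-suc m)) (rec (s≤s (m≤m+n m (m + 0))))

-- Mirrors the definition of `t`, including the junk value at denominator 0.
infixl 7 _÷_
_÷_ : ℕ → ℕ → ℚ
a ÷ zero  = 0ℚ
a ÷ suc c = (+ a) /ℚ suc c

toℚᵘ-÷ : ∀ a c → toℚᵘ (a ÷ suc c) ≃ᵘ mkℚᵘ (+ a) c
toℚᵘ-÷ a c = ℚ.toℚᵘ-fromℚᵘ (mkℚᵘ (+ a) c)

÷-mono-≤ : ∀ {a a′ c c′} → 0 < c → 0 < c′ → a * c′ ≤ a′ * c → a ÷ c ≤ℚ a′ ÷ c′
÷-mono-≤ {a} {a′} {suc c} {suc c′} _ _ le =
  ℚ.toℚᵘ-cancel-≤ (ℚᵘ.≤-respˡ-≃ (ℚᵘ.≃-sym (toℚᵘ-÷ a c)) (ℚᵘ.≤-respʳ-≃ (ℚᵘ.≃-sym (toℚᵘ-÷ a′ c′)) cross))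
  where
  cross : mkℚᵘ (+ a) c ≤ᵘ mkℚᵘ (+ a′) c′
  cross = *≤* (subst₂ ℤ._≤_ (ℤ.pos-* a (suc c′)) (ℤ.pos-* a′ (suc c)) (ℤ.+≤+ le))

÷-monoˡ-≤ : ∀ {a a′} c → a ≤ a′ → a ÷ c ≤ℚ a′ ÷ c
÷-monoˡ-≤ zero    _  = ℚ.≤-refl
÷-monoˡ-≤ {a} {a′} (suc c) le = ÷-mono-≤ {a} {a′} z<s z<s (*-monoˡ-≤ (suc c) le)

n÷n≡1 : ∀ {n} → 0 < n → n ÷ n ≡ 1ℚ
n÷n≡1 {n} n>0 = ℚ.≤-antisym (÷-mono-≤ {n} {1} n>0 z<s (≤-reflexive (*-comm n 1)))
                            (÷-mono-≤ {1} {n} z<s n>0 (≤-reflexive (*-comm 1 n)))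

÷-distribʳ-+ : ∀ a b c → (a + b) ÷ c ≡ a ÷ c +ℚ b ÷ c
÷-distribʳ-+ a b zero    = refl
÷-distribʳ-+ a b (suc c) = ℚ.toℚᵘ-injective (begin
  toℚᵘ ((a + b) ÷ suc c)                  ≈⟨ toℚᵘ-÷ (a + b) c ⟩
  mkℚᵘ (+ (a + b)) c                      ≈⟨ *≡* cross ⟩
  mkℚᵘ (+ a) c +ᵘ mkℚᵘ (+ b) c            ≈⟨ ℚᵘ.+-cong (toℚᵘ-÷ a c) (toℚᵘ-÷ b c) ⟨
  toℚᵘ (a ÷ suc c) +ᵘ toℚᵘ (b ÷ suc c)    ≈⟨ ℚ.toℚᵘ-homo-+ (a ÷ suc c) (b ÷ suc c) ⟨
  toℚᵘ (a ÷ suc c +ℚ b ÷ suc c)           ∎)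
  where
  open ℚᵘ.≃-Reasoning
  distrib : ∀ x y z → (x ℤ.+ y) ℤ.* (z ℤ.* z) ≡ (x ℤ.* z ℤ.+ y ℤ.* z) ℤ.* z
  distrib = ℤ-Ring.solve-∀
  cross : + (a + b) ℤ.* + (suc c * suc c) ≡ (+ a ℤ.* + suc c ℤ.+ + b ℤ.* + suc c) ℤ.* + suc c
  cross = trans (cong₂ ℤ._*_ (ℤ.pos-+ a b) (ℤ.pos-* (suc c) (suc c))) (distrib (+ a) (+ b) (+ suc c))

t≡÷ : ∀ n → t n ≡ s n ÷ s (suc n)
t≡÷ n with s (suc n)
... | zero  = refl
... | suc _ = refl

t-even : ∀ m → t (2 * m) ≡ s m ÷ (s m + s (suc m))
t-even m = trans (t≡÷ (2 * m)) (cong₂ _÷_ (s-even m) (s-odd m))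

t-odd : ∀ m → t (1 + 2 * m) ≡ t m +ℚ 1ℚ
t-odd m = begin
  t (1 + 2 * m)                            ≡⟨ t≡÷ (1 + 2 * m) ⟩
  s (1 + 2 * m) ÷ s (2 + 2 * m)            ≡⟨ cong₂ _÷_ (s-odd m) (s-even-suc m) ⟩
  (s m + s (suc m)) ÷ s (suc m)            ≡⟨ ÷-distribʳ-+ (s m) (s (suc m)) (s (suc m)) ⟩
  s m ÷ s (suc m) +ℚ s (suc m) ÷ s (suc m) ≡⟨ cong₂ _+ℚ_ (sym (t≡÷ m)) (n÷n≡1 (s-pos m)) ⟩
  t m +ℚ 1ℚ                                ∎
  where open ≡-Reasoning

÷-complement : ∀ a b → 0 < a + b → b ÷ (a + b) ≡ 1ℚ -ℚ a ÷ (a + b)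
÷-complement a b p = begin
  b ÷ (a + b)                               ≡⟨ cancel (a ÷ (a + b)) (b ÷ (a + b)) ⟩
  a ÷ (a + b) +ℚ b ÷ (a + b) -ℚ a ÷ (a + b) ≡⟨ cong (_-ℚ a ÷ (a + b)) (÷-distribʳ-+ a b (a + b)) ⟨
  (a + b) ÷ (a + b) -ℚ a ÷ (a + b)          ≡⟨ cong (_-ℚ a ÷ (a + b)) (n÷n≡1 p) ⟩
  1ℚ -ℚ a ÷ (a + b)                         ∎
  where
  open ≡-Reasoning
  open +-*-Solver
  cancel : ∀ x y → y ≡ x +ℚ y -ℚ x
  cancel = solve 2 (λ x y → y := x :+ y :- x) refl

-- Φ d a b sums x/(x+y) - ½ over the 2^d neighbouring pairs (x, y) obtained from (a, b) by inserting
-- x + y between neighbours d times; Φ d (s m) (s (1+m)) is the sum of t(2n) - ½ over 2^d m ≤ n < 2^d (m+1).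
Φ : ℕ → ℕ → ℕ → ℚ
Φ zero    a b = a ÷ (a + b) -ℚ ½
Φ (suc d) a b = Φ d a (a + b) +ℚ Φ d (a + b) b

0<a+[a+b] : ∀ a b → 0 < a + b → 0 < a + (a + b)
0<a+[a+b] a b p = <-≤-trans p (m≤n+m (a + b) a)

0<[a+b]+b : ∀ a b → 0 < a + b → 0 < a + b + b
0<[a+b]+b a b p = <-≤-trans p (m≤m+n (a + b) b)

Φ-antisym : ∀ d {a b} → 0 < a + b → Φ d b a ≡ - Φ d a b
Φ-antisym zero {a} {b} p = begin
  b ÷ (b + a) -ℚ ½               ≡⟨ cong (λ c → b ÷ c -ℚ ½) (+-comm b a) ⟩
  b ÷ (a + b) -ℚ ½               ≡⟨ cong (_-ℚ ½) (÷-complement a b p) ⟩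
  1ℚ -ℚ a ÷ (a + b) -ℚ ½         ≡⟨ reflect (a ÷ (a + b)) ⟩
  - (a ÷ (a + b) -ℚ ½)           ∎
  where
  open ≡-Reasoning
  open +-*-Solver
  reflect : ∀ x → 1ℚ -ℚ x -ℚ ½ ≡ - (x -ℚ ½)
  reflect = solve 1 (λ x → con 1ℚ :- x :- con ½ := :- (x :- con ½)) refl
Φ-antisym (suc d) {a} {b} p = begin
  Φ d b (b + a) +ℚ Φ d (b + a) a         ≡⟨ cong (λ c → Φ d b c +ℚ Φ d c a) (+-comm b a) ⟩
  Φ d b (a + b) +ℚ Φ d (a + b) a         ≡⟨ cong₂ _+ℚ_ (Φ-antisym d (0<[a+b]+b a b p))
                                                        (Φ-antisym d (0<a+[a+b] a b p)) ⟩
  - Φ d (a + b) b +ℚ - Φ d a (a + b)     ≡⟨ ℚ.+-comm (- Φ d (a + b) b) _ ⟩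
  - Φ d a (a + b) +ℚ - Φ d (a + b) b     ≡⟨ ℚ.neg-distrib-+ (Φ d a (a + b)) _ ⟨
  - (Φ d a (a + b) +ℚ Φ d (a + b) b)     ∎
  where open ≡-Reasoning

Φ-1-1 : ∀ d → Φ d 1 1 ≡ 0ℚ
Φ-1-1 zero    = refl
Φ-1-1 (suc d) = trans (cong (Φ d 1 2 +ℚ_) (Φ-antisym d z<s)) (ℚ.+-inverseʳ (Φ d 1 2))

Φ-0-1 : ∀ d → Φ d 0 1 ≡ -½
Φ-0-1 zero    = refl
Φ-0-1 (suc d) = trans (cong₂ _+ℚ_ (Φ-0-1 d) (Φ-1-1 d)) (ℚ.+-identityʳ -½)

Φ-1-0 : ∀ d → Φ d 1 0 ≡ ½
Φ-1-0 d = trans (Φ-antisym d z<s) (cong -_ (Φ-0-1 d))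

mediantˡ-≤ : ∀ a b a′ b′ → a * b′ ≤ a′ * b → a * (a′ + b′) ≤ a′ * (a + b)
mediantˡ-≤ a b a′ b′ le = begin
  a * (a′ + b′)     ≡⟨ *-distribˡ-+ a a′ b′ ⟩
  a * a′ + a * b′   ≤⟨ +-monoʳ-≤ (a * a′) le ⟩
  a * a′ + a′ * b   ≡⟨ cong (_+ a′ * b) (*-comm a a′) ⟩
  a′ * a + a′ * b   ≡⟨ *-distribˡ-+ a′ a b ⟨
  a′ * (a + b)      ∎
  where open ≤-Reasoning

mediantʳ-≤ : ∀ a b a′ b′ → a * b′ ≤ a′ * b → (a + b) * b′ ≤ (a′ + b′) * b
mediantʳ-≤ a b a′ b′ le = begin
  (a + b) * b′      ≡⟨ *-distribʳ-+ b′ a b ⟩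
  a * b′ + b * b′   ≤⟨ +-monoˡ-≤ (b * b′) le ⟩
  a′ * b + b * b′   ≡⟨ cong (λ x → a′ * b + x) (*-comm b b′) ⟩
  a′ * b + b′ * b   ≡⟨ *-distribʳ-+ b a′ b′ ⟨
  (a′ + b′) * b     ∎
  where open ≤-Reasoning

Φ-mono : ∀ d {a b a′ b′} → 0 < a + b → 0 < a′ + b′ → a * b′ ≤ a′ * b → Φ d a b ≤ℚ Φ d a′ b′
Φ-mono zero    {a} {b} {a′} {b′} p p′ le =
  ℚ.+-monoˡ-≤ (- ½) (÷-mono-≤ {a} {a′} p p′ (mediantˡ-≤ a b a′ b′ le))
Φ-mono (suc d) {a} {b} {a′} {b′} p p′ le = ℚ.+-mono-≤
  (Φ-mono d (0<a+[a+b] a b p) (0<a+[a+b] a′ b′ p′) (mediantˡ-≤ a b a′ b′ le))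
  (Φ-mono d (0<[a+b]+b a b p) (0<[a+b]+b a′ b′ p′) (mediantʳ-≤ a b a′ b′ le))

-q≤p≤q⇒∣p∣≤q : ∀ {p q} → - q ≤ℚ p → p ≤ℚ q → ∣ p ∣ ≤ℚ q
-q≤p≤q⇒∣p∣≤q {p} {q} -q≤p p≤q with ℚ.∣p∣≡p∨∣p∣≡-p p
... | inj₁ ∣p∣≡p  = subst (_≤ℚ q) (sym ∣p∣≡p) p≤q
... | inj₂ ∣p∣≡-p = subst₂ _≤ℚ_ (sym ∣p∣≡-p) (⁻¹-involutive q) (ℚ.neg-antimono-≤ -q≤p)

∣Φ∣≤½ : ∀ d {a b} → 0 < a + b → ∣ Φ d a b ∣ ≤ℚ ½
∣Φ∣≤½ d {a} {b} p = -q≤p≤q⇒∣p∣≤q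
  (subst (_≤ℚ Φ d a b) (Φ-0-1 d) (Φ-mono d z<s p z≤n))
  (subst (Φ d a b ≤ℚ_) (Φ-1-0 d) (Φ-mono d p z<s (subst (_≤ 1 * b) (sym (*-zeroʳ a)) z≤n)))

E : ℕ → ℕ → ℚ
E d zero    = 0ℚ
E d (suc M) = E d M +ℚ Φ d (s M) (s (suc M))

Φ-s-double : ∀ d m →
  Φ d (s (2 * m)) (s (1 + 2 * m)) +ℚ Φ d (s (1 + 2 * m)) (s (2 + 2 * m)) ≡ Φ (suc d) (s m) (s (suc m))
Φ-s-double d m rewrite s-even m | s-odd m | s-even-suc m = refl

E-double : ∀ d M → E d (2 * M) ≡ E (suc d) M
E-double d zero    = refl
E-double d (suc M) = begin
  E d (2 * suc M)                                   ≡⟨ cong (E d) (*-suc 2 M) ⟩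
  E d (2 * M) +ℚ Φ d (s (2 * M)) (s (1 + 2 * M)) +ℚ Φ d (s (1 + 2 * M)) (s (2 + 2 * M))
                                                    ≡⟨ ℚ.+-assoc (E d (2 * M)) _ _ ⟩
  E d (2 * M) +ℚ (Φ d (s (2 * M)) (s (1 + 2 * M)) +ℚ Φ d (s (1 + 2 * M)) (s (2 + 2 * M)))
                                                    ≡⟨ cong₂ _+ℚ_ (E-double d M) (Φ-s-double d M) ⟩
  E (suc d) M +ℚ Φ (suc d) (s M) (s (suc M))        ∎
  where open ≡-Reasoning

∣E∣≤ : ∀ d k M → M < 2 ^ k → ∣ E d M ∣ ≤ℚ k ÷ 2
∣E∣≤ d zero    zero    _         = ℚ.≤-refl
∣E∣≤ d zero    (suc M) (s≤s ())
∣E∣≤ d (suc k) M       M<2^[1+k] with parity M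
... | even m = begin
  ∣ E d (2 * m) ∣    ≡⟨ cong ∣_∣ (E-double d m) ⟩
  ∣ E (suc d) m ∣    ≤⟨ ∣E∣≤ (suc d) k m (2*m<2*n⇒m<n M<2^[1+k]) ⟩
  k ÷ 2              ≤⟨ ÷-monoˡ-≤ 2 (n≤1+n k) ⟩
  suc k ÷ 2          ∎
  where open ℚ.≤-Reasoning
... | odd m = begin
  ∣ E d (2 * m) +ℚ φ ∣        ≤⟨ ℚ.∣p+q∣≤∣p∣+∣q∣ (E d (2 * m)) φ ⟩
  ∣ E d (2 * m) ∣ +ℚ ∣ φ ∣     ≡⟨ cong (λ x → ∣ x ∣ +ℚ ∣ φ ∣) (E-double d m) ⟩
  ∣ E (suc d) m ∣ +ℚ ∣ φ ∣     ≤⟨ ℚ.+-mono-≤ (∣E∣≤ (suc d) k m (1+2*m<2*n⇒m<n M<2^[1+k]))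
                                            (∣Φ∣≤½ d (<-≤-trans (s-pos (2 * m)) (m≤n+m _ _))) ⟩
  k ÷ 2 +ℚ 1 ÷ 2              ≡⟨ ÷-distribʳ-+ k 1 2 ⟨
  (k + 1) ÷ 2                 ≡⟨ cong (_÷ 2) (+-comm k 1) ⟩
  suc k ÷ 2                   ∎
  where
  open ℚ.≤-Reasoning
  φ = Φ d (s (2 * m)) (s (1 + 2 * m))

D : ℕ → ℚ
D N = T N -ℚ (3 * N) ÷ 2

D-suc : ∀ N → D (suc N) ≡ D N +ℚ (t N -ℚ 3 ÷ 2)
D-suc N = begin
  T N +ℚ t N -ℚ (3 * suc N) ÷ 2          ≡⟨ cong (λ x → T N +ℚ t N -ℚ x ÷ 2) (*-suc 3 N) ⟩
  T N +ℚ t N -ℚ (3 + 3 * N) ÷ 2          ≡⟨ cong (λ x → T N +ℚ t N -ℚ x ÷ 2) (+-comm 3 (3 * N)) ⟩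
  T N +ℚ t N -ℚ (3 * N + 3) ÷ 2          ≡⟨ cong (T N +ℚ t N -ℚ_) (÷-distribʳ-+ (3 * N) 3 2) ⟩
  T N +ℚ t N -ℚ ((3 * N) ÷ 2 +ℚ 3 ÷ 2)   ≡⟨ regroup (T N) (t N) ((3 * N) ÷ 2) (3 ÷ 2) ⟩
  T N -ℚ (3 * N) ÷ 2 +ℚ (t N -ℚ 3 ÷ 2)   ∎
  where
  open ≡-Reasoning
  open +-*-Solver
  regroup : ∀ x y u v → x +ℚ y -ℚ (u +ℚ v) ≡ x -ℚ u +ℚ (y -ℚ v)
  regroup = solve 4 (λ x y u v → x :+ y :- (u :+ v) := x :- u :+ (y :- v)) refl

D-double   : ∀ M → D (2 * M) ≡ D M +ℚ E 0 M
D-double+1 : ∀ M → D (1 + 2 * M) ≡ D M +ℚ E 0 (suc M) -ℚ 1ℚ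

D-double zero    = refl
D-double (suc M) = begin
  D (2 * suc M)                                   ≡⟨ cong D (*-suc 2 M) ⟩
  D (2 + 2 * M)                                   ≡⟨ D-suc (1 + 2 * M) ⟩
  D (1 + 2 * M) +ℚ (t (1 + 2 * M) -ℚ 3 ÷ 2)       ≡⟨ cong₂ (λ x y → x +ℚ (y -ℚ 3 ÷ 2)) (D-double+1 M) (t-odd M) ⟩
  D M +ℚ E 0 (suc M) -ℚ 1ℚ +ℚ (t M +ℚ 1ℚ -ℚ 3 ÷ 2) ≡⟨ regroup (D M) (E 0 (suc M)) (t M) ⟩
  D M +ℚ (t M -ℚ 3 ÷ 2) +ℚ E 0 (suc M)            ≡⟨ cong (_+ℚ E 0 (suc M)) (D-suc M) ⟨
  D (suc M) +ℚ E 0 (suc M)                        ∎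
  where
  open ≡-Reasoning
  open +-*-Solver
  regroup : ∀ d e x → d +ℚ e -ℚ 1ℚ +ℚ (x +ℚ 1ℚ -ℚ 3 ÷ 2) ≡ d +ℚ (x -ℚ 3 ÷ 2) +ℚ e
  regroup = solve 3 (λ d e x → d :+ e :- con 1ℚ :+ (x :+ con 1ℚ :- con (3 ÷ 2))
                            := d :+ (x :- con (3 ÷ 2)) :+ e) refl

D-double+1 M = begin
  D (1 + 2 * M)                                   ≡⟨ D-suc (2 * M) ⟩
  D (2 * M) +ℚ (t (2 * M) -ℚ 3 ÷ 2)               ≡⟨ cong₂ (λ x y → x +ℚ (y -ℚ 3 ÷ 2)) (D-double M) (t-even M) ⟩
  D M +ℚ E 0 M +ℚ (x -ℚ 3 ÷ 2)                    ≡⟨ regroup (D M) (E 0 M) x ⟩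
  D M +ℚ (E 0 M +ℚ (x -ℚ ½)) -ℚ 1ℚ                ∎
  where
  open ≡-Reasoning
  open +-*-Solver
  x = s M ÷ (s M + s (suc M))
  regroup : ∀ d e x → d +ℚ e +ℚ (x -ℚ 3 ÷ 2) ≡ d +ℚ (e +ℚ (x -ℚ ½)) -ℚ 1ℚ
  regroup = solve 3 (λ d e x → d :+ e :+ (x :- con (3 ÷ 2))
                            := d :+ (e :+ (x :- con ½)) :- con 1ℚ) refl

k[k+3]-step : ∀ k → k * (k + 3) + suc k + 2 ≤ suc k * (suc k + 3)
k[k+3]-step k = subst (k * (k + 3) + suc k + 2 ≤_) (expand k) (m≤m+n _ (suc k))
  where
  expand : ∀ k → k * (k + 3) + suc k + 2 + suc k ≡ suc k * (suc k + 3)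
  expand = ℕ-Ring.solve-∀

∣D∣≤ : ∀ k N → N < 2 ^ k → ∣ D N ∣ ≤ℚ (k * (k + 3)) ÷ 2
∣D∣≤ zero    zero    _         = ℚ.≤-refl
∣D∣≤ zero    (suc N) (s≤s ())
∣D∣≤ (suc k) N       N<2^[1+k] with parity N
... | even M = begin
  ∣ D (2 * M) ∣                            ≡⟨ cong ∣_∣ (D-double M) ⟩
  ∣ D M +ℚ E 0 M ∣                         ≤⟨ ℚ.∣p+q∣≤∣p∣+∣q∣ (D M) (E 0 M) ⟩
  ∣ D M ∣ +ℚ ∣ E 0 M ∣                     ≤⟨ ℚ.+-mono-≤ (∣D∣≤ k M (2*m<2*n⇒m<n N<2^[1+k]))
                                                          (∣E∣≤ 0 (suc k) M (≤-<-trans (m≤m+n M (M + 0)) N<2^[1+k])) ⟩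
  (k * (k + 3)) ÷ 2 +ℚ suc k ÷ 2           ≡⟨ ÷-distribʳ-+ (k * (k + 3)) (suc k) 2 ⟨
  (k * (k + 3) + suc k) ÷ 2                ≤⟨ ÷-monoˡ-≤ 2 (≤-trans (m≤m+n _ 2) (k[k+3]-step k)) ⟩
  (suc k * (suc k + 3)) ÷ 2                ∎
  where open ℚ.≤-Reasoning
... | odd M = begin
  ∣ D (1 + 2 * M) ∣                        ≡⟨ cong ∣_∣ (D-double+1 M) ⟩
  ∣ D M +ℚ E 0 (suc M) -ℚ 1ℚ ∣             ≤⟨ ℚ.∣p-q∣≤∣p∣+∣q∣ (D M +ℚ E 0 (suc M)) 1ℚ ⟩
  ∣ D M +ℚ E 0 (suc M) ∣ +ℚ 1ℚ             ≤⟨ ℚ.+-monoˡ-≤ 1ℚ (ℚ.∣p+q∣≤∣p∣+∣q∣ (D M) (E 0 (suc M))) ⟩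
  ∣ D M ∣ +ℚ ∣ E 0 (suc M) ∣ +ℚ 1ℚ         ≤⟨ ℚ.+-monoˡ-≤ 1ℚ (ℚ.+-mono-≤
                                               (∣D∣≤ k M (1+2*m<2*n⇒m<n N<2^[1+k]))
                                               (∣E∣≤ 0 (suc k) (suc M) (≤-<-trans (s≤s (m≤m+n M (M + 0))) N<2^[1+k]))) ⟩
  (k * (k + 3)) ÷ 2 +ℚ suc k ÷ 2 +ℚ 2 ÷ 2  ≡⟨ cong (_+ℚ 2 ÷ 2) (÷-distribʳ-+ (k * (k + 3)) (suc k) 2) ⟨
  (k * (k + 3) + suc k) ÷ 2 +ℚ 2 ÷ 2       ≡⟨ ÷-distribʳ-+ (k * (k + 3) + suc k) 2 2 ⟨
  (k * (k + 3) + suc k + 2) ÷ 2            ≤⟨ ÷-monoˡ-≤ 2 (k[k+3]-step k) ⟩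
  (suc k * (suc k + 3)) ÷ 2                ∎
  where open ℚ.≤-Reasoning

n<2^[1+⌊log₂n⌋] : ∀ n → n < 2 ^ suc ⌊log₂ n ⌋
n<2^[1+⌊log₂n⌋] n = ≰⇒> λ 2^[1+L]≤n →
  1+n≰n (subst (_≤ ⌊log₂ n ⌋) (⌊log₂[2^n]⌋≡n (suc ⌊log₂ n ⌋)) (⌊log₂⌋-mono-≤ 2^[1+L]≤n))

[1+L][4+L]≤10L² : ∀ {L} → 1 ≤ L → suc L * (suc L + 3) * 1 ≤ 5 * L ^ 2 * 2
[1+L][4+L]≤10L² {suc l} _ =
  subst (suc (suc l) * (suc (suc l) + 3) * 1 ≤_) (expand l) (m≤m+n _ (13 * l + 9 * (l * l)))
  where
  expand : ∀ l → (2 + l) * (2 + l + 3) * 1 + (13 * l + 9 * (l * l)) ≡ 5 * ((1 + l) * ((1 + l) * 1)) * 2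
  expand = ℕ-Ring.solve-∀

corollary3p4 : ∃₂ λ (C N₀ : ℕ) → (N : ℕ) → N₀ ≤ N →
    ∣ T N -ℚ (+ (3 * N)) /ℚ 2 ∣ ≤ℚ (+ (C * ⌊log₂ N ⌋ ^ 2)) /ℚ 1
corollary3p4 = 5 , 2 , λ N 2≤N → let L = ⌊log₂ N ⌋ in begin
  ∣ D N ∣                    ≤⟨ ∣D∣≤ (suc L) N (n<2^[1+⌊log₂n⌋] N) ⟩
  (suc L * (suc L + 3)) ÷ 2  ≤⟨ ÷-mono-≤ {suc L * (suc L + 3)} {5 * L ^ 2} z<s z<s
                                   ([1+L][4+L]≤10L² (⌊log₂⌋-mono-≤ 2≤N)) ⟩
  (5 * L ^ 2) ÷ 1            ∎
  where open ℚ.≤-Reasoning
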